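{- Let $p$ be a prime, $n\ge2$, $m\ge1$, $e\mid p-1$, $\omega\in\mathbb F_p^\times$ of order $e$, $S=\mathbb F_p[x_1,\dots,x_n]$, and $G$ generated by $g_n$ (fixing $x_1,\dots,x_{n-1}$, $x_n\mapsto\omega^{ -1}x_n$) and $g_1,\dots,g_{n-1}$ ($g_k$ fixes $x_i$ for $i\neq k$, $x_k\mapsto x_k-x_n$). With $f_i=x_i^p-x_ix_n^{p-1}$ for $i<n$, let $$B_G=\mathbb F_p[f_1,\dots,f_{n-1}]\text{ -span}\Big\{x_1^{a_1}\cdots x_{n-1}^{a_{n-1}}x_n^{p^m-1}+\mathfrak m^{[p^m]}:0\le a_i<p,\ \textstyle\sum_{i=1}^{n-1}a_i\ge2\Big\}\subseteq S/\mathfrak m^{[p^m]}.$$ Then $$\mathrm{Hilb}(B_G,t)=t^{p^m-1}\Big(\Big(\frac{1-t^p}{1-t}\Big)^{n-1}-(n-1)t-1\Big)\Big(\frac{1-t^{p^m}}{1-t^p}\Big)^{n-1}.$$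
   Context: $\mathfrak m^{[p^m]}=(x_1^{p^m},\dots,x_n^{p^m})$; $S/\mathfrak m^{[p^m]}$ is graded by polynomial degree and $\mathrm{Hilb}(M,t)=\sum_d\dim M_d t^d$. -}

module Defs where

open import Data.Nat as ℕ using (ℕ; zero; suc; _≤_; _<_; _^_; _∸_)
open import Data.Integer as ℤ using (ℤ; +_)
open import Data.Integer.Divisibility as ℤD using ()
open import Data.Fin as Fin using (Fin)
open import Data.Fin.Properties as FinP using ()
open import Data.Vec as Vec using (Vec; []; _∷_; _∷ʳ_)
open import Data.Vec.Properties as VecP using (≡-dec)
open import Data.Vec.Relation.Unary.All as VAll using ()
open import Data.List as List using (List; []; _∷_; _++_)
open import Data.Product using (Σ; _×_; _,_; proj₁; proj₂)
open import Data.Bool using (Bool; true; false; if_then_else_)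
open import Relation.Nullary using (¬_)
open import Relation.Nullary.Decidable using (⌊_⌋)
open import Relation.Binary.PropositionalEquality using (_≡_)

-- Congruence modulo p (coefficients of F_p are represented by integers)

_≡_[mod_] : ℤ → ℤ → ℕ → Set
a ≡ b [mod p ] = (+ p) ℤD.∣ (a ℤ.- b)

HasOrderMod : ℕ → ℤ → ℕ → Set
HasOrderMod p ω e =
  (1 ≤ e) × ((ω ℤ.^ e) ≡ + 1 [mod p ]) ×
  ((j : ℕ) → 1 ≤ j → j < e → ¬ ((ω ℤ.^ j) ≡ + 1 [mod p ]))

-- Multivariate polynomials with integer coefficients in N variables,
-- as formal sums of terms (coefficient, exponent vector).

Poly : ℕ → Set
Poly N = List (ℤ × Vec ℕ N)

mono : ∀ {N} → ℤ → Vec ℕ N → Poly N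
mono c e = (c , e) ∷ []

zeroP : ∀ {N} → Poly N
zeroP = []

_⊕_ : ∀ {N} → Poly N → Poly N → Poly N
P ⊕ Q = P ++ Q

scaleP : ∀ {N} → ℤ → Poly N → Poly N
scaleP c = List.map (λ t → (c ℤ.* proj₁ t , proj₂ t))

_⊗_ : ∀ {N} → Poly N → Poly N → Poly N
P ⊗ Q = List.concatMap
  (λ t → List.map (λ s → (proj₁ t ℤ.* proj₁ s , Vec.zipWith ℕ._+_ (proj₂ t) (proj₂ s))) Q) P

oneP : ∀ {N} → Poly N
oneP = mono (+ 1) (Vec.replicate _ 0)

powP : ∀ {N} → Poly N → ℕ → Poly N
powP P zero = oneP
powP P (suc k) = P ⊗ powP P k

coeff : ∀ {N} → Poly N → Vec ℕ N → ℤ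
coeff P e = List.foldr ℤ._+_ (+ 0)
  (List.map (λ t → if ⌊ ≡-dec ℕ._≟_ (proj₂ t) e ⌋ then proj₁ t else + 0) P)

-- The quotient R = F_p[x_1..x_N] / m^[q]  (q = p^m).  Its F_p-basis is
-- the monomials with all exponents < q; two polynomials define the same
-- element of R iff their coefficients agree mod p at all such monomials.

Reduced : ∀ {N} → ℕ → Vec ℕ N → Set
Reduced q e = VAll.All (λ a → a < q) e

EqR : ∀ {N} → (p q : ℕ) → Poly N → Poly N → Set
EqR {N} p q P Q = (e : Vec ℕ N) → Reduced q e → coeff P e ≡ coeff Q e [mod p ]

HomogR : ∀ {N} → (p q d : ℕ) → Poly N → Set
HomogR {N} p q d P = (e : Vec ℕ N) → Reduced q e → ¬ (Vec.sum e ≡ d) →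
  coeff P e ≡ + 0 [mod p ]

lincomb : ∀ {N r} → Vec ℤ r → Vec (Poly N) r → Poly N
lincomb [] [] = zeroP
lincomb (c ∷ cs) (v ∷ vs) = scaleP c v ⊕ lincomb cs vs

HasDim : ∀ {N} → (p q : ℕ) → (Poly N → Set) → ℕ → Set
HasDim {N} p q V r = Σ (Vec (Poly N) r) λ vs →
  VAll.All V vs ×
  ((cs : Vec ℤ r) → EqR p q (lincomb cs vs) zeroP →
      VAll.All (λ c → c ≡ + 0 [mod p ]) cs) ×
  ((w : Poly N) → V w → Σ (Vec ℤ r) λ cs → EqR p q w (lincomb cs vs))

-- The concrete setting: n = suc k variables x_1..x_k, x_n (x_n = last).

unitV : ∀ {N} → Fin N → Vec ℕ N
unitV i = Vec.tabulate (λ j → if ⌊ j FinP.≟ i ⌋ then 1 else 0)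

scaleV : ∀ {N} → ℕ → Vec ℕ N → Vec ℕ N
scaleV c = Vec.map (ℕ._*_ c)

addV : ∀ {N} → Vec ℕ N → Vec ℕ N → Vec ℕ N
addV = Vec.zipWith ℕ._+_

fPoly : (p k : ℕ) → Fin k → Poly (suc k)
fPoly p k i =
  mono (+ 1) (scaleV p (unitV (Fin.inject₁ i))) ⊕
  mono (ℤ.- + 1) (addV (unitV (Fin.inject₁ i)) (scaleV (p ∸ 1) (unitV (Fin.fromℕ k))))

fMono : (p k : ℕ) → Vec ℕ k → Poly (suc k)
fMono p k b = List.foldr _⊗_ oneP
  (Vec.toList (Vec.zipWith (λ i bi → powP (fPoly p k i) bi) (Vec.allFin k) b))

-- an element of F_p[f_1..f_k], given as a polynomial in k variables
-- (list of (coefficient, exponent vector)) to be evaluated at the f_i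
FPoly : ℕ → Set
FPoly k = List (ℤ × Vec ℕ k)

evalF : (p k : ℕ) → FPoly k → Poly (suc k)
evalF p k h = List.concatMap (λ t → scaleP (proj₁ t) (fMono p k (proj₂ t))) h

Admissible : (p k : ℕ) → Vec ℕ k → Set
Admissible p k a = VAll.All (λ ai → ai < p) a × (2 ≤ Vec.sum a)

genPoly : (k q : ℕ) → Vec ℕ k → Poly (suc k)
genPoly k q a = mono (+ 1) (a ∷ʳ (q ∸ 1))

InBG : (p k m : ℕ) → Poly (suc k) → Set
InBG p k m v =
  Σ (List (FPoly k × Σ (Vec ℕ k) (Admissible p k))) λ L →
    EqR p (p ^ m) v
      (List.concatMap (λ t → evalF p k (proj₁ t) ⊗ genPoly k (p ^ m) (proj₁ (proj₂ t))) L)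

BGdeg : (p k m d : ℕ) → Poly (suc k) → Set
BGdeg p k m d v = InBG p k m v × HomogR p (p ^ m) d v

-- Univariate integer polynomials (coefficient lists, low degree first)

UPoly : Set
UPoly = List ℤ

addU : UPoly → UPoly → UPoly
addU [] ys = ys
addU (x ∷ xs) [] = x ∷ xs
addU (x ∷ xs) (y ∷ ys) = (x ℤ.+ y) ∷ addU xs ys

scaleU : ℤ → UPoly → UPoly
scaleU c = List.map (ℤ._*_ c)

mulU : UPoly → UPoly → UPoly
mulU [] ys = []
mulU (x ∷ xs) ys = addU (scaleU x ys) (+ 0 ∷ mulU xs ys)

monoU : ℤ → ℕ → UPoly
monoU c d = List.replicate d (+ 0) ++ (c ∷ [])

powU : UPoly → ℕ → UPoly
powU P zero = monoU (+ 1) 0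
powU P (suc k) = mulU P (powU P k)

coeffU : UPoly → ℕ → ℤ
coeffU [] d = + 0
coeffU (x ∷ xs) zero = x
coeffU (x ∷ xs) (suc d) = coeffU xs d

-- (1 - t^p)/(1 - t) = 1 + t + ... + t^(p-1)
geomU : ℕ → UPoly
geomU p = List.replicate p (+ 1)

-- (1 - t^(p r))/(1 - t^p) = Σ_{j<r} t^(p j)
stepGeomU : ℕ → ℕ → UPoly
stepGeomU p r = List.foldr addU [] (List.map (λ j → monoU (+ 1) (p ℕ.* j)) (List.upTo r))

hilbRHS : (p k m : ℕ) → UPoly
hilbRHS p k m =
  mulU (monoU (+ 1) (p ^ m ∸ 1))
    (mulU (addU (powU (geomU p) k) (addU (monoU (ℤ.- + k) 1) (monoU (ℤ.- + 1) 0)))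
          (powU (stepGeomU p (p ^ (m ∸ 1))) k))

-- In S/𝔪^[q], q = p^m, multiplication by x_n^(q-1) kills every monomial divisible by x_n, so
-- f^c x^a x_n^(q-1) = x^(p c + a) x_n^(q-1): modulo x_n each f_i = x_i^p - x_i x_n^(p-1) is x_i^p.
-- Hence every element of (B_G)_d is supported on the reduced monomials x^(p c + a) x_n^(q-1) of
-- degree d with 0 ≤ a_i < p, Σ a_i ≥ 2 and 0 ≤ c_i < q/p; these lie in B_G, and being distinct
-- monomials they form a basis. Their number is the coefficient of t^d on the right-hand side, whose
-- three factors count the exponent q - 1 of x_n, the admissible digit vectors a, and the vectors p c.

module Submission where

open import Defs
open import Data.Nat using (ℕ; zero; suc; _+_; _*_; _≤_; _<_; _∸_; _^_; z≤n; s≤s; >-nonZero; nonTrivial⇒n>1)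
open import Data.Nat.Divisibility using (_∣_; _∣0)
open import Data.Nat.Primality using (Prime; prime⇒nonTrivial)
open import Data.Integer using (ℤ; +_)
open import Data.Product using (Σ; _×_; _,_; proj₁; proj₂; ∃₂; uncurry)
open import Data.Sum using (_⊎_; inj₁; inj₂)
open import Data.Empty using (⊥-elim)
open import Data.Bool using (if_then_else_)
open import Data.Fin as Fin using (Fin)
open import Data.List as List using (List; []; _∷_; _++_; length; cartesianProduct)
open import Data.List.Membership.Propositional using (_∈_; _∉_)
open import Data.List.Membership.Propositional.Properties
open import Data.List.Relation.Unary.Any using (here; there)
open import Data.List.Relation.Unary.AllPairs using ([]; _∷_)
open import Data.List.Relation.Unary.Unique.Propositional using (Unique)
open import Data.List.Relation.Binary.Disjoint.Propositional using (Disjoint)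
open import Data.Vec as Vec using (Vec; []; _∷_; _∷ʳ_)
open import Data.Vec.Relation.Unary.All as All using (All; []; _∷_)
open import Function using (_∘_)
open import Relation.Binary using (tri<; tri≈; tri>)
open import Relation.Binary.PropositionalEquality
open import Relation.Nullary using (¬_; yes; no)
open import Relation.Nullary.Decidable using (⌊_⌋; ⌊⌋-map′)

import Data.Nat.Properties as ℕ
import Data.Integer as ℤ
import Data.Integer.Properties as ℤ
import Data.Integer.Divisibility as ℤ
import Data.Fin.Properties as Fin
import Data.List.Properties as List
import Data.List.Relation.Unary.All as ListAll
import Data.List.Relation.Unary.Unique.Propositional.Properties as Unique
import Data.Vec.Properties as Vec
open import Algebra.Properties.CommutativeSemigroup ℕ.+-commutativeSemigroup
  using () renaming (interchange to +-interchange)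

convolution : (ℕ → ℤ) → (ℕ → ℤ) → ℕ → ℤ
convolution f g zero    = f 0 ℤ.* g 0
convolution f g (suc d) = f 0 ℤ.* g (suc d) ℤ.+ convolution (f ∘ suc) g d

convolution-cong : ∀ {f f′ g g′} → (∀ i → f i ≡ f′ i) → (∀ i → g i ≡ g′ i) →
                   ∀ d → convolution f g d ≡ convolution f′ g′ d
convolution-cong f≗ g≗ zero    = cong₂ ℤ._*_ (f≗ 0) (g≗ 0)
convolution-cong f≗ g≗ (suc d) =
  cong₂ ℤ._+_ (cong₂ ℤ._*_ (f≗ 0) (g≗ (suc d))) (convolution-cong (f≗ ∘ suc) g≗ d)

convolution-zeroˡ : ∀ {f} g → (∀ i → f i ≡ + 0) → ∀ d → convolution f g d ≡ + 0
convolution-zeroˡ g f≗0 zero    rewrite f≗0 0 = refl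
convolution-zeroˡ g f≗0 (suc d) rewrite f≗0 0 =
  trans (ℤ.+-identityˡ _) (convolution-zeroˡ g (f≗0 ∘ suc) d)

coeffU-addU : ∀ P Q d → coeffU (addU P Q) d ≡ coeffU P d ℤ.+ coeffU Q d
coeffU-addU []       Q        d       = sym (ℤ.+-identityˡ _)
coeffU-addU (x ∷ xs) []       d       = sym (ℤ.+-identityʳ _)
coeffU-addU (x ∷ xs) (y ∷ ys) zero    = refl
coeffU-addU (x ∷ xs) (y ∷ ys) (suc d) = coeffU-addU xs ys d

coeffU-scaleU : ∀ c P d → coeffU (scaleU c P) d ≡ c ℤ.* coeffU P d
coeffU-scaleU c []       d       = sym (ℤ.*-zeroʳ c)
coeffU-scaleU c (x ∷ xs) zero    = refl
coeffU-scaleU c (x ∷ xs) (suc d) = coeffU-scaleU c xs d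

coeffU-mulU : ∀ P Q d → coeffU (mulU P Q) d ≡ convolution (coeffU P) (coeffU Q) d
coeffU-mulU []       Q d       = sym (convolution-zeroˡ (coeffU Q) (λ _ → refl) d)
coeffU-mulU (x ∷ xs) Q zero    = begin
  coeffU (addU (scaleU x Q) (+ 0 ∷ mulU xs Q)) 0 ≡⟨ coeffU-addU (scaleU x Q) _ 0 ⟩
  coeffU (scaleU x Q) 0 ℤ.+ + 0 ≡⟨ ℤ.+-identityʳ _ ⟩
  coeffU (scaleU x Q) 0         ≡⟨ coeffU-scaleU x Q 0 ⟩
  x ℤ.* coeffU Q 0              ∎
  where open ≡-Reasoning
coeffU-mulU (x ∷ xs) Q (suc d) = begin
  coeffU (addU (scaleU x Q) (+ 0 ∷ mulU xs Q)) (suc d)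
    ≡⟨ coeffU-addU (scaleU x Q) _ (suc d) ⟩
  coeffU (scaleU x Q) (suc d) ℤ.+ coeffU (mulU xs Q) d
    ≡⟨ cong₂ ℤ._+_ (coeffU-scaleU x Q (suc d)) (coeffU-mulU xs Q d) ⟩
  x ℤ.* coeffU Q (suc d) ℤ.+ convolution (coeffU xs) (coeffU Q) d
    ∎
  where open ≡-Reasoning

coeffU-monoU-≡ : ∀ c n → coeffU (monoU c n) n ≡ c
coeffU-monoU-≡ c zero    = refl
coeffU-monoU-≡ c (suc n) = coeffU-monoU-≡ c n

coeffU-monoU-≢ : ∀ c n d → n ≢ d → coeffU (monoU c n) d ≡ + 0
coeffU-monoU-≢ c zero    zero    n≢d = ⊥-elim (n≢d refl)
coeffU-monoU-≢ c zero    (suc d) n≢d = refl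
coeffU-monoU-≢ c (suc n) zero    n≢d = refl
coeffU-monoU-≢ c (suc n) (suc d) n≢d = coeffU-monoU-≢ c n d (n≢d ∘ cong suc)

-- Graded lists and their generating functions

Graded : Set → Set
Graded A = ℕ → List A

_Counts_ : ∀ {A} → UPoly → Graded A → Set
P Counts L = ∀ d → coeffU P d ≡ + length (L d)

Weighted : ∀ {A} → (A → ℕ) → Graded A → Set
Weighted w L = ∀ {x d} → x ∈ L d → w x ≡ d

AllUnique : ∀ {A} → Graded A → Set
AllUnique L = ∀ d → Unique (L d)

module _ {A B : Set} where

  _⊠_ : Graded A → Graded B → Graded (A × B)
  (L ⊠ M) zero    = cartesianProduct (L 0) (M 0)
  (L ⊠ M) (suc d) = cartesianProduct (L 0) (M (suc d)) ++ ((L ∘ suc) ⊠ M) d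

  length-cartesianProduct : (xs : List A) (ys : List B) →
                            length (cartesianProduct xs ys) ≡ length xs * length ys
  length-cartesianProduct []       ys = refl
  length-cartesianProduct (x ∷ xs) ys = begin
    length (List.map (x ,_) ys ++ cartesianProduct xs ys)
      ≡⟨ List.length-++ (List.map (x ,_) ys) ⟩
    length (List.map (x ,_) ys) + length (cartesianProduct xs ys)
      ≡⟨ cong₂ _+_ (List.length-map (x ,_) ys) (length-cartesianProduct xs ys) ⟩
    length ys + length xs * length ys
      ∎
    where open ≡-Reasoning

  +length-cartesianProduct : (xs : List A) (ys : List B) →
                             + length (cartesianProduct xs ys) ≡ + length xs ℤ.* + length ys
  +length-cartesianProduct xs ys =
    trans (cong +_ (length-cartesianProduct xs ys)) (ℤ.pos-* (length xs) (length ys))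

  length-⊠ : ∀ (L : Graded A) (M : Graded B) d →
             + length ((L ⊠ M) d) ≡ convolution (λ i → + length (L i)) (λ j → + length (M j)) d
  length-⊠ L M zero    = +length-cartesianProduct (L 0) (M 0)
  length-⊠ L M (suc d) = begin
    + length (cartesianProduct (L 0) (M (suc d)) ++ ((L ∘ suc) ⊠ M) d)
      ≡⟨ cong +_ (List.length-++ (cartesianProduct (L 0) (M (suc d)))) ⟩
    + (length (cartesianProduct (L 0) (M (suc d))) + length (((L ∘ suc) ⊠ M) d))
      ≡⟨ ℤ.pos-+ (length (cartesianProduct (L 0) (M (suc d)))) _ ⟩
    + length (cartesianProduct (L 0) (M (suc d))) ℤ.+ + length (((L ∘ suc) ⊠ M) d)
      ≡⟨ cong₂ ℤ._+_ (+length-cartesianProduct (L 0) (M (suc d))) (length-⊠ (L ∘ suc) M d) ⟩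
    convolution (λ i → + length (L i)) (λ j → + length (M j)) (suc d)
      ∎
    where open ≡-Reasoning

  mulU-Counts : ∀ {P Q} {L : Graded A} {M : Graded B} →
                P Counts L → Q Counts M → mulU P Q Counts (L ⊠ M)
  mulU-Counts {P} {Q} {L} {M} P≗L Q≗M d = begin
    coeffU (mulU P Q) d                                              ≡⟨ coeffU-mulU P Q d ⟩
    convolution (coeffU P) (coeffU Q) d                              ≡⟨ convolution-cong P≗L Q≗M d ⟩
    convolution (λ i → + length (L i)) (λ j → + length (M j)) d      ≡⟨ length-⊠ L M d ⟨
    + length ((L ⊠ M) d)                                             ∎
    where open ≡-Reasoning

  ∈-⊠⁻ : ∀ (L : Graded A) (M : Graded B) d {x y} → (x , y) ∈ (L ⊠ M) d →
         ∃₂ λ i j → i + j ≡ d × x ∈ L i × y ∈ M j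
  ∈-⊠⁻ L M zero xy∈ =
    let x∈ , y∈ = ∈-cartesianProduct⁻ (L 0) (M 0) xy∈ in 0 , 0 , refl , x∈ , y∈
  ∈-⊠⁻ L M (suc d) xy∈ with ∈-++⁻ (cartesianProduct (L 0) (M (suc d))) xy∈
  ... | inj₁ xy∈₀ = let x∈ , y∈ = ∈-cartesianProduct⁻ (L 0) (M (suc d)) xy∈₀ in 0 , suc d , refl , x∈ , y∈
  ... | inj₂ xy∈′ =
    let i , j , i+j≡d , x∈ , y∈ = ∈-⊠⁻ (L ∘ suc) M d xy∈′ in suc i , j , cong suc i+j≡d , x∈ , y∈

  ∈-⊠⁺ : ∀ (L : Graded A) (M : Graded B) i j {x y} → x ∈ L i → y ∈ M j → (x , y) ∈ (L ⊠ M) (i + j)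
  ∈-⊠⁺ L M zero    zero    x∈ y∈ = ∈-cartesianProduct⁺ x∈ y∈
  ∈-⊠⁺ L M zero    (suc j) x∈ y∈ = ∈-++⁺ˡ (∈-cartesianProduct⁺ x∈ y∈)
  ∈-⊠⁺ L M (suc i) j       x∈ y∈ =
    ∈-++⁺ʳ (cartesianProduct (L 0) (M (suc (i + j)))) (∈-⊠⁺ (L ∘ suc) M i j x∈ y∈)

  ⊠-AllUnique : ∀ {v} {L : Graded A} {M : Graded B} →
                Weighted v L → AllUnique L → AllUnique M → AllUnique (L ⊠ M)
  ⊠-AllUnique wL uL uM zero    = Unique.cartesianProduct⁺ (uL 0) (uM 0)
  ⊠-AllUnique {v} {L} {M} wL uL uM (suc d) =
    Unique.++⁺ (Unique.cartesianProduct⁺ (uL 0) (uM (suc d)))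
               (⊠-AllUnique (λ x∈ → cong (_∸ 1) (wL x∈)) (uL ∘ suc) uM d)
               disjoint
    where
    disjoint : Disjoint (cartesianProduct (L 0) (M (suc d))) (((L ∘ suc) ⊠ M) d)
    disjoint (xy∈₀ , xy∈′) with ∈-cartesianProduct⁻ (L 0) (M (suc d)) xy∈₀ | ∈-⊠⁻ (L ∘ suc) M d xy∈′
    ... | x∈₀ , _ | _ , _ , _ , x∈′ , _ = ℕ.0≢1+n (trans (sym (wL x∈₀)) (wL x∈′))

module _ {A : Set} where

  vectors : Graded A → (k : ℕ) → Graded (Vec A k)
  vectors L zero    zero    = [] ∷ []
  vectors L zero    (suc d) = []
  vectors L (suc k) d       = List.map (uncurry _∷_) ((L ⊠ vectors L k) d)

  powU-Counts : ∀ {P} {L : Graded A} → P Counts L → ∀ k → powU P k Counts vectors L k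
  powU-Counts P≗L zero    zero    = refl
  powU-Counts P≗L zero    (suc d) = refl
  powU-Counts {P} {L} P≗L (suc k) d = begin
    coeffU (mulU P (powU P k)) d
      ≡⟨ mulU-Counts {P = P} {Q = powU P k} P≗L (powU-Counts {P = P} P≗L k) d ⟩
    + length ((L ⊠ vectors L k) d)
      ≡⟨ cong +_ (List.length-map (uncurry _∷_) ((L ⊠ vectors L k) d)) ⟨
    + length (vectors L (suc k) d)
      ∎
    where open ≡-Reasoning

  module _ {w : A → ℕ} {L : Graded A} (wL : Weighted w L) where

    vectors-Weighted : ∀ k → Weighted (Vec.sum ∘ Vec.map w) (vectors L k)
    vectors-Weighted zero    {[]}    {zero} _ = refl
    vectors-Weighted (suc k) {x ∷ v} {d}    v∈ with ∈-map⁻ (uncurry _∷_) v∈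
    ... | (x , v) , xv∈ , refl with ∈-⊠⁻ L (vectors L k) d xv∈
    ... | i , j , refl , x∈ , v∈′ = cong₂ _+_ (wL x∈) (vectors-Weighted k v∈′)

    vectors-AllUnique : AllUnique L → ∀ k → AllUnique (vectors L k)
    vectors-AllUnique uL zero    zero    = ListAll.[] ∷ []
    vectors-AllUnique uL zero    (suc d) = []
    vectors-AllUnique uL (suc k) d       =
      Unique.map⁺ ∷-injective (⊠-AllUnique wL uL (vectors-AllUnique uL k) d)
      where
      ∷-injective : ∀ {xv yu : A × Vec A k} → uncurry _∷_ xv ≡ uncurry _∷_ yu → xv ≡ yu
      ∷-injective {x , v} {y , u} refl = refl

    ∈-vectors⁻ : ∀ k {d v} → v ∈ vectors L k d → All (λ x → x ∈ L (w x)) v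
    ∈-vectors⁻ zero    {zero} {[]} _ = []
    ∈-vectors⁻ (suc k) {d}         v∈ with ∈-map⁻ (uncurry _∷_) v∈
    ... | (x , v) , xv∈ , refl with ∈-⊠⁻ L (vectors L k) d xv∈
    ... | i , j , refl , x∈ , v∈′ = subst (λ i → x ∈ L i) (sym (wL x∈)) x∈ ∷ ∈-vectors⁻ k v∈′

  ∈-vectors⁺ : ∀ (w : A → ℕ) (L : Graded A) {k} {v : Vec A k} →
               All (λ x → x ∈ L (w x)) v → v ∈ vectors L k (Vec.sum (Vec.map w v))
  ∈-vectors⁺ w L []                 = here refl
  ∈-vectors⁺ w L {suc k} (x∈ ∷ xs∈) =
    ∈-map⁺ (uncurry _∷_) (∈-⊠⁺ L (vectors L k) _ _ x∈ (∈-vectors⁺ w L xs∈))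

digits : ℕ → Graded ℕ
digits p u with u ℕ.<? p
... | yes _ = u ∷ []
... | no  _ = []

module _ (p : ℕ) where

  coeffU-geomU-< : ∀ {u} → u < p → coeffU (geomU p) u ≡ + 1
  coeffU-geomU-< = go p
    where
    go : ∀ p {u} → u < p → coeffU (List.replicate p (+ 1)) u ≡ + 1
    go (suc p) {zero}  _         = refl
    go (suc p) {suc u} (s≤s u<p) = go p u<p

  coeffU-geomU-≮ : ∀ {u} → ¬ u < p → coeffU (geomU p) u ≡ + 0
  coeffU-geomU-≮ = go p
    where
    go : ∀ p {u} → ¬ u < p → coeffU (List.replicate p (+ 1)) u ≡ + 0
    go zero    {u}     _   = refl
    go (suc p) {zero}  u≮p = ⊥-elim (u≮p (s≤s z≤n))
    go (suc p) {suc u} u≮p = go p (u≮p ∘ s≤s)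

  geomU-Counts : geomU p Counts digits p
  geomU-Counts u with u ℕ.<? p
  ... | yes u<p = coeffU-geomU-< u<p
  ... | no  u≮p = coeffU-geomU-≮ u≮p

  digits-Weighted : Weighted (λ x → x) (digits p)
  digits-Weighted {x} {u} x∈ with u ℕ.<? p
  digits-Weighted (here refl) | yes _ = refl

  digits-AllUnique : AllUnique (digits p)
  digits-AllUnique u with u ℕ.<? p
  ... | yes _ = ListAll.[] ∷ []
  ... | no  _ = []

  ∈-digits⁺ : ∀ {x} → x < p → x ∈ digits p x
  ∈-digits⁺ {x} x<p with x ℕ.<? p
  ... | yes _   = here refl
  ... | no  x≮p = ⊥-elim (x≮p x<p)

  ∈-digits⁻ : ∀ {x u} → x ∈ digits p u → x < p
  ∈-digits⁻ {x} {u} x∈ with u ℕ.<? p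
  ∈-digits⁻ (here refl) | yes u<p = u<p

fibres : ∀ {A : Set} → (A → ℕ) → List A → Graded A
fibres w xs u = List.filter (λ x → w x ℕ.≟ u) xs

module _ {A : Set} (w : A → ℕ) where

  sumMonoU-Counts : ∀ xs → List.foldr addU [] (List.map (λ x → monoU (+ 1) (w x)) xs) Counts fibres w xs
  sumMonoU-Counts []       u = refl
  sumMonoU-Counts (x ∷ xs) u with w x ℕ.≟ u
  ... | yes refl = begin
    coeffU (addU (monoU (+ 1) (w x)) _) (w x)
      ≡⟨ coeffU-addU (monoU (+ 1) (w x)) _ (w x) ⟩
    coeffU (monoU (+ 1) (w x)) (w x) ℤ.+ _
      ≡⟨ cong₂ ℤ._+_ (coeffU-monoU-≡ (+ 1) (w x)) (sumMonoU-Counts xs (w x)) ⟩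
    + 1 ℤ.+ + length (fibres w xs (w x))
      ≡⟨ ℤ.pos-+ 1 _ ⟨
    + length (x ∷ fibres w xs (w x))
      ≡⟨ cong (+_ ∘ length) (List.filter-accept (λ y → w y ℕ.≟ w x) {xs = xs} refl) ⟨
    + length (fibres w (x ∷ xs) (w x))
      ∎
    where open ≡-Reasoning
  ... | no wx≢u = begin
    coeffU (addU (monoU (+ 1) (w x)) _) u
      ≡⟨ coeffU-addU (monoU (+ 1) (w x)) _ u ⟩
    coeffU (monoU (+ 1) (w x)) u ℤ.+ _
      ≡⟨ cong₂ ℤ._+_ (coeffU-monoU-≢ (+ 1) (w x) u wx≢u) (sumMonoU-Counts xs u) ⟩
    + 0 ℤ.+ + length (fibres w xs u)
      ≡⟨ ℤ.+-identityˡ _ ⟩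
    + length (fibres w xs u)
      ≡⟨ cong (+_ ∘ length) (List.filter-reject (λ y → w y ℕ.≟ u) {xs = xs} wx≢u) ⟨
    + length (fibres w (x ∷ xs) u)
      ∎
    where open ≡-Reasoning

  fibres-Weighted : ∀ xs → Weighted w (fibres w xs)
  fibres-Weighted xs x∈ = proj₂ (∈-filter⁻ (λ y → w y ℕ.≟ _) {xs = xs} x∈)

  fibres-AllUnique : ∀ {xs} → Unique xs → AllUnique (fibres w xs)
  fibres-AllUnique xs! u = Unique.filter⁺ (λ y → w y ℕ.≟ u) xs!

  ∈-fibres⁺ : ∀ {xs x} → x ∈ xs → x ∈ fibres w xs (w x)
  ∈-fibres⁺ {xs} x∈ = ∈-filter⁺ (λ y → w y ℕ.≟ _) {xs = xs} x∈ refl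

  ∈-fibres⁻ : ∀ {xs x u} → x ∈ fibres w xs u → x ∈ xs
  ∈-fibres⁻ {xs} x∈ = proj₁ (∈-filter⁻ (λ y → w y ℕ.≟ _) {xs = xs} x∈)

monoU-Counts : ∀ n → monoU (+ 1) n Counts fibres (λ l → l) (n ∷ [])
monoU-Counts n d = trans (sym (trans (coeffU-addU (monoU (+ 1) n) [] d) (ℤ.+-identityʳ _)))
                         (sumMonoU-Counts (λ l → l) (n ∷ []) d)

multiples : ℕ → ℕ → Graded ℕ
multiples p r = fibres (p *_) (List.upTo r)

stepGeomU-Counts : ∀ p r → stepGeomU p r Counts multiples p r
stepGeomU-Counts p r = sumMonoU-Counts (p *_) (List.upTo r)

admissibleExponents : ℕ → (k : ℕ) → Graded (Vec ℕ k)
admissibleExponents p k zero          = []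
admissibleExponents p k (suc zero)    = []
admissibleExponents p k (suc (suc d)) = vectors (digits p) k (suc (suc d))

admissibleU : ℕ → ℕ → UPoly
admissibleU p k = addU (powU (geomU p) k) (addU (monoU (ℤ.- + k) 1) (monoU (ℤ.- + 1) 0))

module _ (p : ℕ) (2≤p : 2 ≤ p) where

  private
    0<p : 0 < p
    0<p = ℕ.<-trans (s≤s z≤n) 2≤p

  coeffU-powU-geomU-0 : ∀ k → coeffU (powU (geomU p) k) 0 ≡ + 1
  coeffU-powU-geomU-0 zero    = refl
  coeffU-powU-geomU-0 (suc k) = begin
    coeffU (mulU (geomU p) (powU (geomU p) k)) 0     ≡⟨ coeffU-mulU (geomU p) (powU (geomU p) k) 0 ⟩
    coeffU (geomU p) 0 ℤ.* coeffU (powU (geomU p) k) 0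
                                                     ≡⟨ cong (ℤ._* coeffU (powU (geomU p) k) 0) (coeffU-geomU-< p 0<p) ⟩
    + 1 ℤ.* coeffU (powU (geomU p) k) 0              ≡⟨ ℤ.*-identityˡ _ ⟩
    coeffU (powU (geomU p) k) 0                      ≡⟨ coeffU-powU-geomU-0 k ⟩
    + 1                                              ∎
    where open ≡-Reasoning

  coeffU-powU-geomU-1 : ∀ k → coeffU (powU (geomU p) k) 1 ≡ + k
  coeffU-powU-geomU-1 zero    = refl
  coeffU-powU-geomU-1 (suc k) = begin
    coeffU (mulU (geomU p) (powU (geomU p) k)) 1
      ≡⟨ coeffU-mulU (geomU p) (powU (geomU p) k) 1 ⟩
    coeffU (geomU p) 0 ℤ.* coeffU (powU (geomU p) k) 1 ℤ.+ coeffU (geomU p) 1 ℤ.* coeffU (powU (geomU p) k) 0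
      ≡⟨ cong₂ (λ a b → a ℤ.* coeffU (powU (geomU p) k) 1 ℤ.+ b ℤ.* coeffU (powU (geomU p) k) 0)
               (coeffU-geomU-< p 0<p) (coeffU-geomU-< p 2≤p) ⟩
    + 1 ℤ.* coeffU (powU (geomU p) k) 1 ℤ.+ + 1 ℤ.* coeffU (powU (geomU p) k) 0
      ≡⟨ cong₂ ℤ._+_ (ℤ.*-identityˡ (coeffU (powU (geomU p) k) 1))
                     (ℤ.*-identityˡ (coeffU (powU (geomU p) k) 0)) ⟩
    coeffU (powU (geomU p) k) 1 ℤ.+ coeffU (powU (geomU p) k) 0
      ≡⟨ cong₂ ℤ._+_ (coeffU-powU-geomU-1 k) (coeffU-powU-geomU-0 k) ⟩
    + k ℤ.+ + 1
      ≡⟨ cong +_ (ℕ.+-comm k 1) ⟩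
    + suc k
      ∎
    where open ≡-Reasoning

  admissibleU-Counts : ∀ k → admissibleU p k Counts admissibleExponents p k
  admissibleU-Counts k d = trans (coeffU-addU (powU (geomU p) k) _ d)
    (trans (cong (ℤ._+_ (coeffU (powU (geomU p) k) d)) (coeffU-addU (monoU (ℤ.- + k) 1) (monoU (ℤ.- + 1) 0) d))
           (by-degree d))
    where
    by-degree : ∀ d → coeffU (powU (geomU p) k) d ℤ.+ (coeffU (monoU (ℤ.- + k) 1) d ℤ.+ coeffU (monoU (ℤ.- + 1) 0) d)
                      ≡ + length (admissibleExponents p k d)
    by-degree zero                rewrite coeffU-powU-geomU-0 k = refl
    by-degree (suc zero)          rewrite coeffU-powU-geomU-1 k =
      trans (cong (ℤ._+_ (+ k)) (ℤ.+-identityʳ (ℤ.- + k))) (ℤ.+-inverseʳ (+ k))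
    by-degree d@(suc (suc _)) =
      trans (ℤ.+-identityʳ _) (powU-Counts {P = geomU p} (geomU-Counts p) k d)

-- (l , a , c) indexes the monomial x^(p c + a) x_n^l of (B_G)_d.
basisIndices : (p k m : ℕ) → Graded (ℕ × Vec ℕ k × Vec ℕ k)
basisIndices p k m =
  fibres (λ l → l) (p ^ m ∸ 1 ∷ []) ⊠ (admissibleExponents p k ⊠ vectors (multiples p (p ^ (m ∸ 1))) k)

hilbRHS-Counts : ∀ p k m → 2 ≤ p → hilbRHS p k m Counts basisIndices p k m
hilbRHS-Counts p k m 2≤p =
  mulU-Counts {P = monoU (+ 1) (p ^ m ∸ 1)} (monoU-Counts (p ^ m ∸ 1))
    (mulU-Counts {P = admissibleU p k} (admissibleU-Counts p 2≤p k)
      (powU-Counts {P = stepGeomU p (p ^ (m ∸ 1))} (stepGeomU-Counts p (p ^ (m ∸ 1))) k))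

module _ (p k : ℕ) where

  admissibleExponents-Weighted : Weighted Vec.sum (admissibleExponents p k)
  admissibleExponents-Weighted {a} {d = suc (suc d)} a∈ =
    trans (cong Vec.sum (sym (Vec.map-id a))) (vectors-Weighted (digits-Weighted p) k a∈)

  admissibleExponents-AllUnique : AllUnique (admissibleExponents p k)
  admissibleExponents-AllUnique zero          = []
  admissibleExponents-AllUnique (suc zero)    = []
  admissibleExponents-AllUnique (suc (suc d)) =
    vectors-AllUnique (digits-Weighted p) (digits-AllUnique p) k (suc (suc d))

  ∈-admissibleExponents⁻ : ∀ {a d} → a ∈ admissibleExponents p k d → Admissible p k a
  ∈-admissibleExponents⁻ {a} {d = suc (suc d)} a∈ =
    All.map (∈-digits⁻ p) (∈-vectors⁻ (digits-Weighted p) k a∈) ,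
    subst (2 ≤_) (sym (admissibleExponents-Weighted a∈)) (s≤s (s≤s z≤n))

  ∈-admissibleExponents⁺ : ∀ {a} → Admissible p k a → a ∈ admissibleExponents p k (Vec.sum a)
  ∈-admissibleExponents⁺ {a} (a<p , 2≤Σa) =
    at-degree 2≤Σa (subst (λ d → a ∈ vectors (digits p) k d) (cong Vec.sum (Vec.map-id a))
                          (∈-vectors⁺ (λ x → x) (digits p) (All.map (∈-digits⁺ p) a<p)))
    where
    at-degree : ∀ {d} → 2 ≤ d → a ∈ vectors (digits p) k d → a ∈ admissibleExponents p k d
    at-degree {suc zero}    (s≤s ())
    at-degree {suc (suc d)} _        a∈ = a∈

module _ (p r k : ℕ) where

  multiples-Weighted : Weighted (p *_) (multiples p r)
  multiples-Weighted = fibres-Weighted (p *_) (List.upTo r)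

  ∈-vectors-multiples⁻ : ∀ {c d} → c ∈ vectors (multiples p r) k d → All (_< r) c
  ∈-vectors-multiples⁻ c∈ = All.map (∈-upTo⁻ ∘ ∈-fibres⁻ (p *_)) (∈-vectors⁻ multiples-Weighted k c∈)

  ∈-vectors-multiples⁺ : ∀ {c} → All (_< r) c → c ∈ vectors (multiples p r) k (Vec.sum (Vec.map (p *_) c))
  ∈-vectors-multiples⁺ c<r = ∈-vectors⁺ (p *_) (multiples p r) (All.map (∈-fibres⁺ (p *_) ∘ ∈-upTo⁺) c<r)

record IsBasisIndex (p k m d : ℕ) (l : ℕ) (a c : Vec ℕ k) : Set where
  field
    top        : l ≡ p ^ m ∸ 1
    admissible : Admissible p k a
    bounded    : All (_< p ^ (m ∸ 1)) c
    degree     : l + (Vec.sum a + Vec.sum (Vec.map (p *_) c)) ≡ d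

module _ (p k m : ℕ) where

  private
    s : ℕ
    s = p ^ m ∸ 1
    Q′ : ℕ
    Q′ = p ^ (m ∸ 1)

  basisIndices-AllUnique : AllUnique (basisIndices p k m)
  basisIndices-AllUnique =
    ⊠-AllUnique (fibres-Weighted (λ l → l) (s ∷ [])) (fibres-AllUnique (λ l → l) {xs = s ∷ []} (ListAll.[] ∷ []))
      (⊠-AllUnique (admissibleExponents-Weighted p k) (admissibleExponents-AllUnique p k)
        (vectors-AllUnique (multiples-Weighted p Q′ k)
          (fibres-AllUnique (p *_) (Unique.upTo⁺ Q′)) k))

  ∈-basisIndices⁻ : ∀ {d l a c} → (l , a , c) ∈ basisIndices p k m d → IsBasisIndex p k m d l a c
  ∈-basisIndices⁻ {d} {l} {a} {c} i∈
    with ∈-⊠⁻ (fibres (λ l → l) (s ∷ [])) (admissibleExponents p k ⊠ vectors (multiples p Q′) k) d i∈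
  ... | i , j , refl , l∈ , ac∈ with ∈-⊠⁻ (admissibleExponents p k) (vectors (multiples p Q′) k) j ac∈
  ... | i′ , _ , refl , a∈ , c∈ = record
    { top        = ∈-singleton (∈-fibres⁻ (λ l → l) {u = i} l∈)
    ; admissible = ∈-admissibleExponents⁻ p k {d = i′} a∈
    ; bounded    = ∈-vectors-multiples⁻ p Q′ k c∈
    ; degree     = cong₂ _+_ (fibres-Weighted (λ l → l) (s ∷ []) {d = i} l∈) (cong₂ _+_
                     (admissibleExponents-Weighted p k {d = i′} a∈)
                     (vectors-Weighted (multiples-Weighted p Q′ k) k c∈))
    }
    where
    ∈-singleton : l ∈ s ∷ [] → l ≡ s
    ∈-singleton (here l≡s) = l≡s

  ∈-basisIndices⁺ : ∀ {d l a c} → IsBasisIndex p k m d l a c → (l , a , c) ∈ basisIndices p k m d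
  ∈-basisIndices⁺ {d} {l} {a} {c} i = subst (λ d → (l , a , c) ∈ basisIndices p k m d) degree
    (∈-⊠⁺ (fibres (λ l → l) (s ∷ [])) (admissibleExponents p k ⊠ vectors (multiples p Q′) k) l _
      (∈-fibres⁺ (λ l → l) (here top))
      (∈-⊠⁺ (admissibleExponents p k) (vectors (multiples p Q′) k) (Vec.sum a) _
        (∈-admissibleExponents⁺ p k admissible) (∈-vectors-multiples⁺ p Q′ k bounded)))
    where open IsBasisIndex i

module _ {N : ℕ} where

  coeffᵗ : ℤ × Vec ℕ N → Vec ℕ N → ℤ
  coeffᵗ t e = if ⌊ Vec.≡-dec ℕ._≟_ (proj₂ t) e ⌋ then proj₁ t else + 0

  coeffᵗ-≡ : ∀ c e → coeffᵗ (c , e) e ≡ c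
  coeffᵗ-≡ c e with Vec.≡-dec ℕ._≟_ e e
  ... | yes _   = refl
  ... | no  e≢e = ⊥-elim (e≢e refl)

  coeffᵗ-≢ : ∀ c {v e} → v ≢ e → coeffᵗ (c , v) e ≡ + 0
  coeffᵗ-≢ c {v} {e} v≢e with Vec.≡-dec ℕ._≟_ v e
  ... | yes v≡e = ⊥-elim (v≢e v≡e)
  ... | no  _   = refl

  coeff-++ : ∀ (P Q : Poly N) e → coeff (P ++ Q) e ≡ coeff P e ℤ.+ coeff Q e
  coeff-++ []      Q e = sym (ℤ.+-identityˡ _)
  coeff-++ (t ∷ P) Q e = trans (cong (ℤ._+_ (coeffᵗ t e)) (coeff-++ P Q e)) (sym (ℤ.+-assoc (coeffᵗ t e) _ _))

  coeff-concatMap-≡0 : ∀ {A : Set} (F : A → Poly N) e → (∀ x → coeff (F x) e ≡ + 0) →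
                       ∀ xs → coeff (List.concatMap F xs) e ≡ + 0
  coeff-concatMap-≡0 F e F≡0 []       = refl
  coeff-concatMap-≡0 F e F≡0 (x ∷ xs) =
    trans (coeff-++ (F x) _ e) (cong₂ ℤ._+_ (F≡0 x) (coeff-concatMap-≡0 F e F≡0 xs))

coeffᵗ-∷ʳ : ∀ {N} c (v : Vec ℕ N) x e → coeffᵗ (c , v ∷ʳ x) (e ∷ʳ x) ≡ coeffᵗ (c , v) e
coeffᵗ-∷ʳ c v x e with Vec.≡-dec ℕ._≟_ v e
... | yes refl = coeffᵗ-≡ c (v ∷ʳ x)
... | no  v≢e  = coeffᵗ-≢ c (v≢e ∘ Vec.∷ʳ-injectiveˡ v e)

addV-∷ʳ : ∀ {N} (u v : Vec ℕ N) x y → addV (u ∷ʳ x) (v ∷ʳ y) ≡ addV u v ∷ʳ (x + y)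
addV-∷ʳ []      []      x y = refl
addV-∷ʳ (a ∷ u) (b ∷ v) x y = cong (a + b ∷_) (addV-∷ʳ u v x y)

-- The substitution x_n ↦ 0

mulᵗ : ∀ {N} → ℤ × Vec ℕ N → ℤ × Vec ℕ N → ℤ × Vec ℕ N
mulᵗ t s = proj₁ t ℤ.* proj₁ s , Vec.zipWith _+_ (proj₂ t) (proj₂ s)

module _ {k : ℕ} where

  substLast0ᵗ : ℤ → Vec ℕ k → ℕ → Poly k
  substLast0ᵗ c b zero    = (c , b) ∷ []
  substLast0ᵗ c b (suc _) = []

  substLast0 : Poly (suc k) → Poly k
  substLast0 = List.concatMap (λ t → substLast0ᵗ (proj₁ t) (Vec.init (proj₂ t)) (Vec.last (proj₂ t)))

  substLast0-∷ʳ : ∀ c b l P → substLast0 ((c , b ∷ʳ l) ∷ P) ≡ substLast0ᵗ c b l ++ substLast0 P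
  substLast0-∷ʳ c b l P = cong₂ (λ b l → substLast0ᵗ c b l ++ substLast0 P) (Vec.init-∷ʳ l b) (Vec.last-∷ʳ l b)

  substLast0-++ : ∀ P Q → substLast0 (P ++ Q) ≡ substLast0 P ++ substLast0 Q
  substLast0-++ P Q = trans (cong List.concat (List.map-++ f P Q)) (sym (List.concat-++ (List.map f P) (List.map f Q)))
    where
    f : ℤ × Vec ℕ (suc k) → Poly k
    f t = substLast0ᵗ (proj₁ t) (Vec.init (proj₂ t)) (Vec.last (proj₂ t))

  substLast0-mulᵗ-0 : ∀ c b Q →
                      substLast0 (List.map (mulᵗ (c , b ∷ʳ 0)) Q) ≡ List.map (mulᵗ (c , b)) (substLast0 Q)
  substLast0-mulᵗ-0 c b []             = refl
  substLast0-mulᵗ-0 c b ((c′ , v) ∷ Q) with Vec.initLast v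
  ... | b′ , l′ , refl = begin
    substLast0 ((c ℤ.* c′ , addV (b ∷ʳ 0) (b′ ∷ʳ l′)) ∷ List.map (mulᵗ (c , b ∷ʳ 0)) Q)
      ≡⟨ cong (λ v → substLast0 ((c ℤ.* c′ , v) ∷ List.map (mulᵗ (c , b ∷ʳ 0)) Q))
              (addV-∷ʳ b b′ 0 l′) ⟩
    substLast0 ((c ℤ.* c′ , addV b b′ ∷ʳ l′) ∷ List.map (mulᵗ (c , b ∷ʳ 0)) Q)
      ≡⟨ substLast0-∷ʳ (c ℤ.* c′) (addV b b′) l′ (List.map (mulᵗ (c , b ∷ʳ 0)) Q) ⟩
    substLast0ᵗ (c ℤ.* c′) (addV b b′) l′ ++ substLast0 (List.map (mulᵗ (c , b ∷ʳ 0)) Q)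
      ≡⟨ cong₂ _++_ (multiplied l′) (substLast0-mulᵗ-0 c b Q) ⟩
    List.map (mulᵗ (c , b)) (substLast0ᵗ c′ b′ l′) ++ List.map (mulᵗ (c , b)) (substLast0 Q)
      ≡⟨ List.map-++ (mulᵗ (c , b)) (substLast0ᵗ c′ b′ l′) _ ⟨
    List.map (mulᵗ (c , b)) (substLast0ᵗ c′ b′ l′ ++ substLast0 Q)
      ∎
    where
    open ≡-Reasoning
    multiplied : ∀ l → substLast0ᵗ (c ℤ.* c′) (addV b b′) l ≡ List.map (mulᵗ (c , b)) (substLast0ᵗ c′ b′ l)
    multiplied zero    = refl
    multiplied (suc _) = refl

  substLast0-mulᵗ-suc : ∀ c b l Q → substLast0 (List.map (mulᵗ (c , b ∷ʳ suc l)) Q) ≡ []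
  substLast0-mulᵗ-suc c b l []             = refl
  substLast0-mulᵗ-suc c b l ((c′ , v) ∷ Q) with Vec.initLast v
  ... | b′ , l′ , refl = begin
    substLast0 ((c ℤ.* c′ , addV (b ∷ʳ suc l) (b′ ∷ʳ l′)) ∷ List.map (mulᵗ (c , b ∷ʳ suc l)) Q)
      ≡⟨ cong (λ v → substLast0 ((c ℤ.* c′ , v) ∷ List.map (mulᵗ (c , b ∷ʳ suc l)) Q))
              (addV-∷ʳ b b′ (suc l) l′) ⟩
    substLast0 ((c ℤ.* c′ , addV b b′ ∷ʳ suc (l + l′)) ∷ List.map (mulᵗ (c , b ∷ʳ suc l)) Q)
      ≡⟨ substLast0-∷ʳ (c ℤ.* c′) (addV b b′) (suc (l + l′)) (List.map (mulᵗ (c , b ∷ʳ suc l)) Q) ⟩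
    substLast0 (List.map (mulᵗ (c , b ∷ʳ suc l)) Q)
      ≡⟨ substLast0-mulᵗ-suc c b l Q ⟩
    []
      ∎
    where open ≡-Reasoning

  substLast0-⊗ : ∀ P Q → substLast0 (P ⊗ Q) ≡ substLast0 P ⊗ substLast0 Q
  substLast0-⊗ []            Q = refl
  substLast0-⊗ ((c , v) ∷ P) Q with Vec.initLast v
  ... | b , l , refl = trans (substLast0-++ (List.map (mulᵗ (c , b ∷ʳ l)) Q) (P ⊗ Q)) (by-last l)
    where
    by-last : ∀ l → substLast0 (List.map (mulᵗ (c , b ∷ʳ l)) Q) ++ substLast0 (P ⊗ Q)
                    ≡ (substLast0ᵗ c b l ++ substLast0 P) ⊗ substLast0 Q
    by-last zero    = cong₂ _++_ (substLast0-mulᵗ-0 c b Q) (substLast0-⊗ P Q)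
    by-last (suc l) = cong₂ _++_ (substLast0-mulᵗ-suc c b l Q) (substLast0-⊗ P Q)

  substLast0-scaleP : ∀ a P → substLast0 (scaleP a P) ≡ scaleP a (substLast0 P)
  substLast0-scaleP a []            = refl
  substLast0-scaleP a ((c , v) ∷ P) with Vec.initLast v
  ... | b , l , refl = begin
    substLast0ᵗ (a ℤ.* c) b l ++ substLast0 (scaleP a P) ≡⟨ cong₂ _++_ (scaled l) (substLast0-scaleP a P) ⟩
    scaleP a (substLast0ᵗ c b l) ++ scaleP a (substLast0 P) ≡⟨ List.map-++ _ (substLast0ᵗ c b l) _ ⟨
    scaleP a (substLast0ᵗ c b l ++ substLast0 P)          ∎
    where
    open ≡-Reasoning
    scaled : ∀ l → substLast0ᵗ (a ℤ.* c) b l ≡ scaleP a (substLast0ᵗ c b l)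
    scaled zero    = refl
    scaled (suc _) = refl

  substLast0-oneP : substLast0 oneP ≡ oneP
  substLast0-oneP = trans (cong (λ v → substLast0 ((+ 1 , v) ∷ [])) (replicate-∷ʳ k))
                          (substLast0-∷ʳ (+ 1) (Vec.replicate k 0) 0 [])
    where
    replicate-∷ʳ : ∀ n → Vec.replicate (suc n) 0 ≡ Vec.replicate n 0 ∷ʳ 0
    replicate-∷ʳ zero    = refl
    replicate-∷ʳ (suc n) = cong (0 ∷_) (replicate-∷ʳ n)

  substLast0-powP : ∀ P n → substLast0 (powP P n) ≡ powP (substLast0 P) n
  substLast0-powP P zero    = substLast0-oneP
  substLast0-powP P (suc n) = trans (substLast0-⊗ P (powP P n)) (cong (substLast0 P ⊗_) (substLast0-powP P n))

  substLast0-product : ∀ Ps → substLast0 (List.foldr _⊗_ oneP Ps) ≡ List.foldr _⊗_ oneP (List.map substLast0 Ps)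
  substLast0-product []       = substLast0-oneP
  substLast0-product (P ∷ Ps) = trans (substLast0-⊗ P _) (cong (substLast0 P ⊗_) (substLast0-product Ps))

sumV : ∀ {N} → List (Vec ℕ N) → Vec ℕ N
sumV = List.foldr addV (Vec.replicate _ 0)

sumV-0∷ : ∀ {N} (vs : List (Vec ℕ N)) → sumV (List.map (0 ∷_) vs) ≡ 0 ∷ sumV vs
sumV-0∷ []       = refl
sumV-0∷ (v ∷ vs) = cong (addV (0 ∷ v)) (sumV-0∷ vs)

module _ {N : ℕ} where

  powP-mono : ∀ (v : Vec ℕ N) n → powP (mono (+ 1) v) n ≡ mono (+ 1) (Vec.map (n *_) v)
  powP-mono v zero    = cong (mono (+ 1)) (sym (Vec.map-const v 0))
  powP-mono v (suc n) = trans (cong (mono (+ 1) v ⊗_) (powP-mono v n)) (cong (mono (+ 1)) (add-multiple v))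
    where
    add-multiple : ∀ {M} (u : Vec ℕ M) → addV u (Vec.map (n *_) u) ≡ Vec.map (suc n *_) u
    add-multiple []      = refl
    add-multiple (x ∷ u) = cong (x + n * x ∷_) (add-multiple u)

  product-mono : ∀ (vs : List (Vec ℕ N)) →
                 List.foldr _⊗_ oneP (List.map (mono (+ 1)) vs) ≡ mono (+ 1) (sumV vs)
  product-mono []       = refl
  product-mono (v ∷ vs) = cong (mono (+ 1) v ⊗_) (product-mono vs)

tabulate-∷ʳ : ∀ {A : Set} {n} (f : Fin (suc n) → A) →
              Vec.tabulate f ≡ Vec.tabulate (f ∘ Fin.inject₁) ∷ʳ f (Fin.fromℕ n)
tabulate-∷ʳ {n = zero}  f = refl
tabulate-∷ʳ {n = suc n} f = cong (f Fin.zero ∷_) (tabulate-∷ʳ (f ∘ Fin.suc))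

tabulate-zero : ∀ k → Vec.tabulate {n = k} (λ _ → 0) ≡ Vec.replicate k 0
tabulate-zero zero    = refl
tabulate-zero (suc k) = cong (0 ∷_) (tabulate-zero k)

unitV-inject₁ : ∀ {k} (i : Fin k) → unitV (Fin.inject₁ i) ≡ unitV i ∷ʳ 0
unitV-inject₁ {k} i = trans (tabulate-∷ʳ (λ j → if ⌊ j Fin.≟ Fin.inject₁ i ⌋ then 1 else 0))
                            (cong₂ _∷ʳ_ (Vec.tabulate-cong entry) last-entry)
  where
  entry : ∀ j → (if ⌊ Fin.inject₁ j Fin.≟ Fin.inject₁ i ⌋ then 1 else 0) ≡ (if ⌊ j Fin.≟ i ⌋ then 1 else 0)
  entry j with j Fin.≟ i | Fin.inject₁ j Fin.≟ Fin.inject₁ i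
  ... | yes _    | yes _   = refl
  ... | yes refl | no  i≢i = ⊥-elim (i≢i refl)
  ... | no  j≢i  | yes eq  = ⊥-elim (j≢i (Fin.inject₁-injective eq))
  ... | no  _    | no  _   = refl
  last-entry : (if ⌊ Fin.fromℕ k Fin.≟ Fin.inject₁ i ⌋ then 1 else 0) ≡ 0
  last-entry with Fin.fromℕ k Fin.≟ Fin.inject₁ i
  ... | yes eq = ⊥-elim (Fin.fromℕ≢inject₁ eq)
  ... | no  _  = refl

unitV-fromℕ : ∀ k → unitV (Fin.fromℕ k) ≡ Vec.replicate k 0 ∷ʳ 1
unitV-fromℕ k = trans (tabulate-∷ʳ (λ j → if ⌊ j Fin.≟ Fin.fromℕ k ⌋ then 1 else 0))
                      (cong₂ _∷ʳ_ (trans (Vec.tabulate-cong entry) (tabulate-zero k)) last-entry)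
  where
  entry : ∀ j → (if ⌊ Fin.inject₁ j Fin.≟ Fin.fromℕ k ⌋ then 1 else 0) ≡ 0
  entry j with Fin.inject₁ j Fin.≟ Fin.fromℕ k
  ... | yes eq = ⊥-elim (Fin.fromℕ≢inject₁ (sym eq))
  ... | no  _  = refl
  last-entry : (if ⌊ Fin.fromℕ k Fin.≟ Fin.fromℕ k ⌋ then 1 else 0) ≡ 1
  last-entry with Fin.fromℕ k Fin.≟ Fin.fromℕ k
  ... | yes _   = refl
  ... | no  k≢k = ⊥-elim (k≢k refl)

unitV-suc : ∀ {k} (i : Fin k) → unitV (Fin.suc i) ≡ 0 ∷ unitV i
unitV-suc i = cong (0 ∷_) (Vec.tabulate-cong (λ j → cong (if_then 1 else 0) (⌊⌋-map′ _ _ (j Fin.≟ i))))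

substLast0-fPoly : ∀ p k (i : Fin k) → 2 ≤ p → substLast0 (fPoly p k i) ≡ mono (+ 1) (scaleV p (unitV i))
substLast0-fPoly (suc zero)       k i (s≤s ())
-- p ≥ 2 makes the x_n-exponent p - 1 of the second term x_i x_n^(p-1) of f_i positive.
substLast0-fPoly p@(suc (suc p′)) k i _ = begin
  substLast0 ((+ 1 , scaleV p (unitV (Fin.inject₁ i))) ∷
              (ℤ.- + 1 , addV (unitV (Fin.inject₁ i)) (scaleV (p ∸ 1) (unitV (Fin.fromℕ k)))) ∷ [])
    ≡⟨ cong₂ (λ u w → substLast0 ((+ 1 , u) ∷ (ℤ.- + 1 , w) ∷ [])) x_i^p x_ix_n^[p-1] ⟩
  substLast0 ((+ 1 , scaleV p (unitV i) ∷ʳ 0) ∷ (ℤ.- + 1 , x_i ∷ʳ suc (p′ * 1)) ∷ [])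
    ≡⟨ substLast0-∷ʳ (+ 1) (scaleV p (unitV i)) 0 ((ℤ.- + 1 , x_i ∷ʳ suc (p′ * 1)) ∷ []) ⟩
  (+ 1 , scaleV p (unitV i)) ∷ substLast0 ((ℤ.- + 1 , x_i ∷ʳ suc (p′ * 1)) ∷ [])
    ≡⟨ cong ((+ 1 , scaleV p (unitV i)) ∷_) (substLast0-∷ʳ (ℤ.- + 1) x_i (suc (p′ * 1)) []) ⟩
  mono (+ 1) (scaleV p (unitV i))
    ∎
  where
  open ≡-Reasoning
  x_i : Vec ℕ k
  x_i = addV (unitV i) (scaleV (suc p′) (Vec.replicate k 0))
  x_i^p : scaleV p (unitV (Fin.inject₁ i)) ≡ scaleV p (unitV i) ∷ʳ 0
  x_i^p = trans (cong (scaleV p) (unitV-inject₁ i))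
                (trans (Vec.map-∷ʳ (p *_) 0 (unitV i)) (cong (scaleV p (unitV i) ∷ʳ_) (ℕ.*-zeroʳ p)))
  x_ix_n^[p-1] : addV (unitV (Fin.inject₁ i)) (scaleV (p ∸ 1) (unitV (Fin.fromℕ k))) ≡ x_i ∷ʳ suc (p′ * 1)
  x_ix_n^[p-1] = begin
    addV (unitV (Fin.inject₁ i)) (scaleV (suc p′) (unitV (Fin.fromℕ k)))
      ≡⟨ cong₂ (λ u w → addV u (scaleV (suc p′) w)) (unitV-inject₁ i) (unitV-fromℕ k) ⟩
    addV (unitV i ∷ʳ 0) (scaleV (suc p′) (Vec.replicate k 0 ∷ʳ 1))
      ≡⟨ cong (addV (unitV i ∷ʳ 0)) (Vec.map-∷ʳ (suc p′ *_) 1 (Vec.replicate k 0)) ⟩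
    addV (unitV i ∷ʳ 0) (scaleV (suc p′) (Vec.replicate k 0) ∷ʳ suc p′ * 1)
      ≡⟨ addV-∷ʳ (unitV i) _ 0 (suc p′ * 1) ⟩
    x_i ∷ʳ suc (p′ * 1)
      ∎

module _ (p : ℕ) where

  scaledUnit : ∀ {k} → Fin k → ℕ → Vec ℕ k
  scaledUnit i n = Vec.map (n *_) (scaleV p (unitV i))

  scaledUnit-zero : ∀ {k} n → scaledUnit (Fin.zero {k}) n ≡ p * n ∷ Vec.replicate k 0
  scaledUnit-zero {k} n = cong₂ _∷_ (trans (cong (n *_) (ℕ.*-identityʳ p)) (ℕ.*-comm n p)) (rest k)
    where
    rest : ∀ k → Vec.map (n *_) (scaleV p (Vec.tabulate {n = k} (λ _ → 0))) ≡ Vec.replicate k 0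
    rest zero    = refl
    rest (suc k) = cong₂ _∷_ (trans (cong (n *_) (ℕ.*-zeroʳ p)) (ℕ.*-zeroʳ n)) (rest k)

  scaledUnit-suc : ∀ {k} (i : Fin k) n → scaledUnit (Fin.suc i) n ≡ 0 ∷ scaledUnit i n
  scaledUnit-suc i n = begin
    Vec.map (n *_) (scaleV p (unitV (Fin.suc i)))
      ≡⟨ cong (Vec.map (n *_) ∘ scaleV p) (unitV-suc i) ⟩
    n * (p * 0) ∷ scaledUnit i n
      ≡⟨ cong (_∷ scaledUnit i n) (trans (cong (n *_) (ℕ.*-zeroʳ p)) (ℕ.*-zeroʳ n)) ⟩
    0 ∷ scaledUnit i n
      ∎
    where open ≡-Reasoning

  zipWith-scaledUnit-suc : ∀ {k n} (g : Fin n → Fin k) (b : Vec ℕ n) →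
                           Vec.zipWith scaledUnit (Vec.tabulate (Fin.suc ∘ g)) b
                           ≡ Vec.map (0 ∷_) (Vec.zipWith scaledUnit (Vec.tabulate g) b)
  zipWith-scaledUnit-suc g []      = refl
  zipWith-scaledUnit-suc g (x ∷ b) =
    cong₂ _∷_ (scaledUnit-suc (g Fin.zero) x) (zipWith-scaledUnit-suc (g ∘ Fin.suc) b)

  sumV-scaledUnits : ∀ {k} (b : Vec ℕ k) → sumV (Vec.toList (Vec.zipWith scaledUnit (Vec.allFin k) b)) ≡ scaleV p b
  sumV-scaledUnits []              = refl
  sumV-scaledUnits {suc k} (x ∷ b) = begin
    addV (scaledUnit Fin.zero x) (sumV (Vec.toList (Vec.zipWith scaledUnit (Vec.tabulate Fin.suc) b)))
      ≡⟨ cong₂ addV (scaledUnit-zero x) (cong (sumV ∘ Vec.toList) (zipWith-scaledUnit-suc (λ i → i) b)) ⟩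
    addV (p * x ∷ Vec.replicate k 0) (sumV (Vec.toList (Vec.map (0 ∷_) units)))
      ≡⟨ cong (addV (p * x ∷ Vec.replicate k 0) ∘ sumV) (Vec.toList-map (0 ∷_) units) ⟩
    addV (p * x ∷ Vec.replicate k 0) (sumV (List.map (0 ∷_) (Vec.toList units)))
      ≡⟨ cong (addV (p * x ∷ Vec.replicate k 0)) (sumV-0∷ (Vec.toList units)) ⟩
    p * x + 0 ∷ addV (Vec.replicate k 0) (sumV (Vec.toList units))
      ≡⟨ cong₂ _∷_ (ℕ.+-identityʳ (p * x)) (Vec.zipWith-identityˡ ℕ.+-identityˡ _) ⟩
    p * x ∷ sumV (Vec.toList units)
      ≡⟨ cong (p * x ∷_) (sumV-scaledUnits b) ⟩
    scaleV p (x ∷ b)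
      ∎
    where
    open ≡-Reasoning
    units : Vec (Vec ℕ k) k
    units = Vec.zipWith scaledUnit (Vec.allFin k) b

map-toList-zipWith : ∀ {A B C D : Set} {n} (h : C → D) {g : A → B → C} {g′ : A → B → D} →
                     (∀ x y → h (g x y) ≡ g′ x y) → ∀ (xs : Vec A n) ys →
                     List.map h (Vec.toList (Vec.zipWith g xs ys)) ≡ Vec.toList (Vec.zipWith g′ xs ys)
map-toList-zipWith h hg≗g′ []       []       = refl
map-toList-zipWith h hg≗g′ (x ∷ xs) (y ∷ ys) = cong₂ _∷_ (hg≗g′ x y) (map-toList-zipWith h hg≗g′ xs ys)

substLast0-fMono : ∀ p k (b : Vec ℕ k) → 2 ≤ p → substLast0 (fMono p k b) ≡ mono (+ 1) (scaleV p b)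
substLast0-fMono p k b 2≤p = begin
  substLast0 (List.foldr _⊗_ oneP (Vec.toList factors))
    ≡⟨ substLast0-product (Vec.toList factors) ⟩
  List.foldr _⊗_ oneP (List.map substLast0 (Vec.toList factors))
    ≡⟨ cong (List.foldr _⊗_ oneP) (map-toList-zipWith substLast0 factor (Vec.allFin k) b) ⟩
  List.foldr _⊗_ oneP (Vec.toList (Vec.zipWith (λ i n → mono (+ 1) (scaledUnit p i n)) (Vec.allFin k) b))
    ≡⟨ cong (List.foldr _⊗_ oneP) (map-toList-zipWith (mono (+ 1)) (λ _ _ → refl) (Vec.allFin k) b) ⟨
  List.foldr _⊗_ oneP (List.map (mono (+ 1)) (Vec.toList units))
    ≡⟨ product-mono (Vec.toList units) ⟩
  mono (+ 1) (sumV (Vec.toList units))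
    ≡⟨ cong (mono (+ 1)) (sumV-scaledUnits p b) ⟩
  mono (+ 1) (scaleV p b)
    ∎
  where
  open ≡-Reasoning
  factors : Vec (Poly (suc k)) k
  factors = Vec.zipWith (λ i n → powP (fPoly p k i) n) (Vec.allFin k) b
  units : Vec (Vec ℕ k) k
  units = Vec.zipWith (scaledUnit p) (Vec.allFin k) b
  factor : ∀ i n → substLast0 (powP (fPoly p k i) n) ≡ mono (+ 1) (scaledUnit p i n)
  factor i n = trans (substLast0-powP (fPoly p k i) n)
                     (trans (cong (λ P → powP P n) (substLast0-fPoly p k i 2≤p)) (powP-mono (scaleV p (unitV i)) n))

substLast0-evalF : ∀ p k (h : FPoly k) → 2 ≤ p →
                   substLast0 (evalF p k h) ≡ List.map (λ t → proj₁ t , scaleV p (proj₂ t)) h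
substLast0-evalF p k []            2≤p = refl
substLast0-evalF p k ((c , x) ∷ h) 2≤p = begin
  substLast0 (scaleP c (fMono p k x) ++ evalF p k h)
    ≡⟨ substLast0-++ (scaleP c (fMono p k x)) (evalF p k h) ⟩
  substLast0 (scaleP c (fMono p k x)) ++ substLast0 (evalF p k h)
    ≡⟨ cong₂ _++_ (trans (substLast0-scaleP c (fMono p k x)) (cong (scaleP c) (substLast0-fMono p k x 2≤p)))
                  (substLast0-evalF p k h 2≤p) ⟩
  (c ℤ.* + 1 , scaleV p x) ∷ List.map (λ t → proj₁ t , scaleV p (proj₂ t)) h
    ≡⟨ cong (λ c′ → (c′ , scaleV p x) ∷ _) (ℤ.*-identityʳ c) ⟩
  (c , scaleV p x) ∷ List.map (λ t → proj₁ t , scaleV p (proj₂ t)) h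
    ∎
  where open ≡-Reasoning

shiftExponents : ∀ {N} → Vec ℕ N → Poly N → Poly N
shiftExponents v = List.map (λ t → proj₁ t , addV (proj₂ t) v)

⊗-mono : ∀ {N} (P : Poly N) v → P ⊗ mono (+ 1) v ≡ shiftExponents v P
⊗-mono []            v = refl
⊗-mono ((c , u) ∷ P) v = cong₂ _∷_ (cong (_, addV u v) (ℤ.*-identityʳ c)) (⊗-mono P v)

module _ {k : ℕ} (a : Vec ℕ k) (s : ℕ) (b : Vec ℕ k) where

  coeff-shift-below : ∀ {l} → l < s → ∀ P → coeff (shiftExponents (a ∷ʳ s) P) (b ∷ʳ l) ≡ + 0
  coeff-shift-below l<s []            = refl
  coeff-shift-below {l} l<s ((c , v) ∷ P) with Vec.initLast v
  ... | u , y , refl = cong₂ ℤ._+_ missed (coeff-shift-below l<s P)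
    where
    missed : coeffᵗ (c , addV (u ∷ʳ y) (a ∷ʳ s)) (b ∷ʳ l) ≡ + 0
    missed = coeffᵗ-≢ c λ eq → ℕ.<⇒≱ l<s (ℕ.≤-trans (ℕ.m≤n+m s y)
      (ℕ.≤-reflexive (Vec.∷ʳ-injectiveʳ (addV u a) b (trans (sym (addV-∷ʳ u a y s)) eq))))

  coeff-shift-at : ∀ P → coeff (shiftExponents (a ∷ʳ s) P) (b ∷ʳ s) ≡ coeff (shiftExponents a (substLast0 P)) b
  coeff-shift-at []            = refl
  coeff-shift-at ((c , v) ∷ P) with Vec.initLast v
  ... | u , y , refl = begin
    coeffᵗ (c , addV (u ∷ʳ y) (a ∷ʳ s)) (b ∷ʳ s) ℤ.+ coeff (shiftExponents (a ∷ʳ s) P) (b ∷ʳ s)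
      ≡⟨ cong₂ ℤ._+_ (by-last y) (coeff-shift-at P) ⟩
    coeff (shiftExponents a (substLast0ᵗ c u y)) b ℤ.+ coeff (shiftExponents a (substLast0 P)) b
      ≡⟨ coeff-++ (shiftExponents a (substLast0ᵗ c u y)) _ b ⟨
    coeff (shiftExponents a (substLast0ᵗ c u y) ++ shiftExponents a (substLast0 P)) b
      ≡⟨ cong (λ Z → coeff Z b) (List.map-++ _ (substLast0ᵗ c u y) (substLast0 P)) ⟨
    coeff (shiftExponents a (substLast0ᵗ c u y ++ substLast0 P)) b
      ∎
    where
    open ≡-Reasoning
    by-last : ∀ y → coeffᵗ (c , addV (u ∷ʳ y) (a ∷ʳ s)) (b ∷ʳ s)
                    ≡ coeff (shiftExponents a (substLast0ᵗ c u y)) b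
    by-last zero    = trans (cong (λ v → coeffᵗ (c , v) (b ∷ʳ s)) (addV-∷ʳ u a 0 s))
                            (trans (coeffᵗ-∷ʳ c (addV u a) s b) (sym (ℤ.+-identityʳ _)))
    by-last (suc y) = coeffᵗ-≢ c λ eq → ℕ.m≢1+n+m s
      (sym (Vec.∷ʳ-injectiveʳ (addV u a) b (trans (sym (addV-∷ʳ u a (suc y) s)) eq)))

-- Subspaces supported on a set of reduced monomials

≡⇒≡[mod] : ∀ p {x y : ℤ} → x ≡ y → x ≡ y [mod p ]
≡⇒≡[mod] p {x} refl = subst (λ z → (+ p) ℤ.∣ z) (sym (ℤ.+-inverseʳ x)) (p ∣0)

module _ {N : ℕ} where

  open import Data.List.Membership.DecPropositional (Vec.≡-dec {n = N} ℕ._≟_) using (_∈?_)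

  monomials : (vs : List (Vec ℕ N)) → Vec (Poly N) (length vs)
  monomials []       = []
  monomials (v ∷ vs) = mono (+ 1) v ∷ monomials vs

  coefficientsAt : Poly N → (vs : List (Vec ℕ N)) → Vec ℤ (length vs)
  coefficientsAt w []       = []
  coefficientsAt w (v ∷ vs) = coeff w v ∷ coefficientsAt w vs

  coeff-lincomb-∉ : ∀ {e} vs cs → e ∉ vs → coeff (lincomb cs (monomials vs)) e ≡ + 0
  coeff-lincomb-∉ []       []       e∉ = refl
  coeff-lincomb-∉ (v ∷ vs) (c ∷ cs) e∉ =
    cong₂ ℤ._+_ (coeffᵗ-≢ (c ℤ.* + 1) (e∉ ∘ here ∘ sym)) (coeff-lincomb-∉ vs cs (e∉ ∘ there))

  coeff-lincomb-coefficientsAt : ∀ w {e vs} → Unique vs → e ∈ vs →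
                                 coeff (lincomb (coefficientsAt w vs) (monomials vs)) e ≡ coeff w e
  coeff-lincomb-coefficientsAt w {vs = v ∷ vs} (v∉vs ∷ vs!) (here refl) = begin
    coeffᵗ (coeff w v ℤ.* + 1 , v) v ℤ.+ coeff (lincomb (coefficientsAt w vs) (monomials vs)) v
      ≡⟨ cong₂ ℤ._+_ (coeffᵗ-≡ _ v)
                     (coeff-lincomb-∉ vs (coefficientsAt w vs) (λ v∈ → ListAll.lookup v∉vs v∈ refl)) ⟩
    coeff w v ℤ.* + 1 ℤ.+ + 0
      ≡⟨ trans (ℤ.+-identityʳ _) (ℤ.*-identityʳ _) ⟩
    coeff w v
      ∎
    where open ≡-Reasoning
  coeff-lincomb-coefficientsAt w {vs = v ∷ vs} (v∉vs ∷ vs!) (there e∈) =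
    trans (cong₂ ℤ._+_ (coeffᵗ-≢ _ (ListAll.lookup v∉vs e∈)) (coeff-lincomb-coefficientsAt w vs! e∈))
          (ℤ.+-identityˡ _)

  module _ (p q : ℕ) where

    monomials-independent : ∀ {vs} → Unique vs → (∀ {v} → v ∈ vs → Reduced q v) → (cs : Vec ℤ (length vs)) →
                            EqR p q (lincomb cs (monomials vs)) zeroP → All (λ c → c ≡ + 0 [mod p ]) cs
    monomials-independent {[]}     []           _   []       _   = []
    monomials-independent {v ∷ vs} (v∉vs ∷ vs!) red (c ∷ cs) eq0 =
      head ∷ monomials-independent vs! (red ∘ there) cs tail
      where
      rest-at-v : coeff (lincomb cs (monomials vs)) v ≡ + 0
      rest-at-v = coeff-lincomb-∉ vs cs (λ v∈ → ListAll.lookup v∉vs v∈ refl)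
      head : c ≡ + 0 [mod p ]
      head = subst (λ z → z ≡ + 0 [mod p ])
                   (trans (cong₂ ℤ._+_ (coeffᵗ-≡ (c ℤ.* + 1) v) rest-at-v)
                          (trans (ℤ.+-identityʳ _) (ℤ.*-identityʳ c)))
                   (eq0 v (red (here refl)))
      tail : EqR p q (lincomb cs (monomials vs)) zeroP
      tail e e-red with Vec.≡-dec ℕ._≟_ v e
      ... | yes refl = ≡⇒≡[mod] p rest-at-v
      ... | no  v≢e  = subst (λ z → z ≡ + 0 [mod p ])
                             (trans (cong (ℤ._+ coeff (lincomb cs (monomials vs)) e) (coeffᵗ-≢ (c ℤ.* + 1) v≢e))
                                    (ℤ.+-identityˡ (coeff (lincomb cs (monomials vs)) e)))
                             (eq0 e e-red)

    monomials-HasDim : ∀ (V : Poly N → Set) {vs} → Unique vs → (∀ {v} → v ∈ vs → Reduced q v) →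
                       (∀ {v} → v ∈ vs → V (mono (+ 1) v)) →
                       (∀ {w} → V w → ∀ {e} → Reduced q e → e ∉ vs → coeff w e ≡ + 0 [mod p ]) →
                       HasDim p q V (length vs)
    monomials-HasDim V {vs} vs! red inV supported =
      monomials vs , all-in inV , monomials-independent vs! red , spanned
      where
      all-in : ∀ {vs} → (∀ {v} → v ∈ vs → V (mono (+ 1) v)) → All V (monomials vs)
      all-in {[]}     _   = []
      all-in {v ∷ vs} inV = inV (here refl) ∷ all-in (inV ∘ there)
      spanned : ∀ w → V w → Σ (Vec ℤ (length vs)) λ cs → EqR p q w (lincomb cs (monomials vs))
      spanned w w∈V = coefficientsAt w vs , agree
        where
        agree : EqR p q w (lincomb (coefficientsAt w vs) (monomials vs))
        agree e e-red with e ∈? vs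
        ... | yes e∈ = ≡⇒≡[mod] p (sym (coeff-lincomb-coefficientsAt w vs! e∈))
        ... | no  e∉ = subst (λ z → coeff w e ≡ z [mod p ])
                             (sym (coeff-lincomb-∉ vs (coefficientsAt w vs) e∉))
                             (supported w∈V e-red e∉)

Unique-map⁺ : ∀ {A B : Set} (f : A → B) {xs} → (∀ {x y} → x ∈ xs → y ∈ xs → f x ≡ f y → x ≡ y) →
              Unique xs → Unique (List.map f xs)
Unique-map⁺ f {[]}     inj []          = []
Unique-map⁺ f {x ∷ xs} inj (x∉ ∷ xs!) =
  ListAll.tabulate fresh ∷ Unique-map⁺ f (λ x∈ y∈ → inj (there x∈) (there y∈)) xs!
  where
  fresh : ∀ {z} → z ∈ List.map f xs → f x ≢ z
  fresh z∈ fx≡z with ∈-map⁻ f z∈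
  ... | y , y∈ , refl = ListAll.lookup x∉ y∈ (inj (here refl) (there y∈) fx≡z)

All-∷ʳ⁺ : ∀ {A : Set} {P : A → Set} {n} {v : Vec A n} {x} → All P v → P x → All P (v ∷ʳ x)
All-∷ʳ⁺ []        px = px ∷ []
All-∷ʳ⁺ (py ∷ pv) px = py ∷ All-∷ʳ⁺ pv px

All-∷ʳ⁻ : ∀ {A : Set} {P : A → Set} {n} (v : Vec A n) {x} → All P (v ∷ʳ x) → All P v × P x
All-∷ʳ⁻ []      (px ∷ [])  = [] , px
All-∷ʳ⁻ (y ∷ v) (py ∷ pvx) = let pv , px = All-∷ʳ⁻ v pvx in py ∷ pv , px

sum-∷ʳ : ∀ {n} (v : Vec ℕ n) x → Vec.sum (v ∷ʳ x) ≡ Vec.sum v + x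
sum-∷ʳ []      x = ℕ.+-identityʳ x
sum-∷ʳ (y ∷ v) x = trans (cong (_+_ y) (sum-∷ʳ v x)) (sym (ℕ.+-assoc y (Vec.sum v) x))

sum-addV : ∀ {n} (u v : Vec ℕ n) → Vec.sum (addV u v) ≡ Vec.sum u + Vec.sum v
sum-addV []      []      = refl
sum-addV (x ∷ u) (y ∷ v) = trans (cong (_+_ (x + y)) (sum-addV u v)) (+-interchange x y (Vec.sum u) (Vec.sum v))

module _ (p : ℕ) where

  digit-< : ∀ {y Y x} → x < p → y < Y → p * y + x < p * Y
  digit-< {y} {Y} {x} x<p y<Y = begin-strict
    p * y + x   <⟨ ℕ.+-monoʳ-< (p * y) x<p ⟩
    p * y + p   ≡⟨ trans (ℕ.+-comm (p * y) p) (sym (ℕ.*-suc p y)) ⟩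
    p * suc y   ≤⟨ ℕ.*-monoʳ-≤ p y<Y ⟩
    p * Y       ∎
    where open ℕ.≤-Reasoning

  digit-<⁻ : ∀ {y Y x} → p * y + x < p * Y → y < Y
  digit-<⁻ {y} {Y} {x} lt = ℕ.*-cancelˡ-< p y Y (ℕ.≤-<-trans (ℕ.m≤m+n (p * y) x) lt)

  digit-injective : ∀ {y y′ x x′} → x < p → x′ < p → p * y + x ≡ p * y′ + x′ → y ≡ y′ × x ≡ x′
  digit-injective {y} {y′} {x} {x′} x<p x′<p eq with ℕ.<-cmp y y′
  ... | tri≈ _ refl _ = refl , ℕ.+-cancelˡ-≡ (p * y) x x′ eq
  ... | tri< y<y′ _ _ = ⊥-elim (ℕ.<⇒≱ (digit-< x<p y<y′) (subst (p * y′ ≤_) (sym eq) (ℕ.m≤m+n (p * y′) x′)))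
  ... | tri> _ _ y′<y = ⊥-elim (ℕ.<⇒≱ (digit-< x′<p y′<y) (subst (p * y ≤_) eq (ℕ.m≤m+n (p * y) x)))

  digits-< : ∀ {n Y} {c a : Vec ℕ n} → All (_< Y) c → All (_< p) a → All (_< p * Y) (addV (scaleV p c) a)
  digits-< []           []           = []
  digits-< (y<Y ∷ c<Y) (x<p ∷ a<p) = digit-< x<p y<Y ∷ digits-< c<Y a<p

  digits-<⁻ : ∀ {n Y} (c a : Vec ℕ n) → All (_< p * Y) (addV (scaleV p c) a) → All (_< Y) c
  digits-<⁻ []      []      []          = []
  digits-<⁻ (y ∷ c) (x ∷ a) (lt ∷ lts) = digit-<⁻ lt ∷ digits-<⁻ c a lts

  digits-injective : ∀ {n} {c c′ a a′ : Vec ℕ n} → All (_< p) a → All (_< p) a′ →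
                     addV (scaleV p c) a ≡ addV (scaleV p c′) a′ → c ≡ c′ × a ≡ a′
  digits-injective {c = []}    {[]}     []          []            refl = refl , refl
  digits-injective {c = _ ∷ _} {_ ∷ _} (x<p ∷ a<p) (x′<p ∷ a′<p) eq with Vec.∷-injective eq
  ... | head , tail with digit-injective x<p x′<p head | digits-injective a<p a′<p tail
  ... | refl , refl | refl , refl = refl , refl

module _ (p k q : ℕ) (2≤p : 2 ≤ p) (h : FPoly k) (a b : Vec ℕ k) where

  private
    images : Poly k
    images = shiftExponents a (List.map (λ t → proj₁ t , scaleV p (proj₂ t)) h)

  coeff-evalF⊗genPoly-below : ∀ {l} → l < q ∸ 1 → coeff (evalF p k h ⊗ genPoly k q a) (b ∷ʳ l) ≡ + 0
  coeff-evalF⊗genPoly-below {l} l<s =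
    trans (cong (λ P → coeff P (b ∷ʳ l)) (⊗-mono (evalF p k h) (a ∷ʳ (q ∸ 1))))
          (coeff-shift-below a (q ∸ 1) b l<s (evalF p k h))

  coeff-evalF⊗genPoly-top : coeff (evalF p k h ⊗ genPoly k q a) (b ∷ʳ (q ∸ 1)) ≡ coeff images b
  coeff-evalF⊗genPoly-top = begin
    coeff (evalF p k h ⊗ genPoly k q a) (b ∷ʳ (q ∸ 1))
      ≡⟨ cong (λ P → coeff P (b ∷ʳ (q ∸ 1))) (⊗-mono (evalF p k h) (a ∷ʳ (q ∸ 1))) ⟩
    coeff (shiftExponents (a ∷ʳ (q ∸ 1)) (evalF p k h)) (b ∷ʳ (q ∸ 1))
      ≡⟨ coeff-shift-at a (q ∸ 1) b (evalF p k h) ⟩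
    coeff (shiftExponents a (substLast0 (evalF p k h))) b
      ≡⟨ cong (λ P → coeff (shiftExponents a P) b) (substLast0-evalF p k h 2≤p) ⟩
    coeff images b
      ∎
    where open ≡-Reasoning

  coeff-images-absent : (∀ x → addV (scaleV p x) a ≢ b) → coeff images b ≡ + 0
  coeff-images-absent b≢ = go h
    where
    go : ∀ h → coeff (shiftExponents a (List.map (λ t → proj₁ t , scaleV p (proj₂ t)) h)) b ≡ + 0
    go []            = refl
    go ((c , x) ∷ h) = cong₂ ℤ._+_ (coeffᵗ-≢ c (b≢ x)) (go h)

-- A monomial basis of (B_G)_d

module _ (p k m′ : ℕ) (2≤p : 2 ≤ p) where

  private
    m : ℕ
    m = suc m′
    q : ℕ
    q = p ^ m
    s : ℕ
    s = q ∸ 1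

    s<q : s < q
    s<q = ∸1< (ℕ.m^n>0 p {{>-nonZero (ℕ.<-trans (s≤s z≤n) 2≤p)}} m)
      where
      ∸1< : ∀ {n} → 0 < n → n ∸ 1 < n
      ∸1< {suc n} _ = ℕ.n<1+n n

    <q⇒≤s : ∀ {l} → l < q → l ≤ s
    <q⇒≤s = go
      where
      go : ∀ {l n} → l < n → l ≤ n ∸ 1
      go (s≤s l≤n) = l≤n

  basisExponent : ℕ × Vec ℕ k × Vec ℕ k → Vec ℕ (suc k)
  basisExponent (l , a , c) = addV (scaleV p c) a ∷ʳ l

  basisMonomials : ℕ → List (Vec ℕ (suc k))
  basisMonomials d = List.map basisExponent (basisIndices p k m d)

  basisExponent-degree : ∀ l a c →
                         Vec.sum (basisExponent (l , a , c)) ≡ l + (Vec.sum a + Vec.sum (Vec.map (p *_) c))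
  basisExponent-degree l a c = begin
    Vec.sum (addV (scaleV p c) a ∷ʳ l)                 ≡⟨ sum-∷ʳ (addV (scaleV p c) a) l ⟩
    Vec.sum (addV (scaleV p c) a) + l                  ≡⟨ cong (_+ l) (sum-addV (scaleV p c) a) ⟩
    Vec.sum (scaleV p c) + Vec.sum a + l               ≡⟨ ℕ.+-comm _ l ⟩
    l + (Vec.sum (scaleV p c) + Vec.sum a)             ≡⟨ cong (_+_ l) (ℕ.+-comm (Vec.sum (scaleV p c)) (Vec.sum a)) ⟩
    l + (Vec.sum a + Vec.sum (Vec.map (p *_) c))       ∎
    where open ≡-Reasoning

  basisExponent-reduced : ∀ {d l a c} → IsBasisIndex p k m d l a c → Reduced q (basisExponent (l , a , c))
  basisExponent-reduced i = All-∷ʳ⁺ (digits-< p bounded (proj₁ admissible)) (subst (_< q) (sym top) s<q)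
    where open IsBasisIndex i

  basisMonomials-unique : ∀ d → Unique (basisMonomials d)
  basisMonomials-unique d = Unique-map⁺ basisExponent injective (basisIndices-AllUnique p k m d)
    where
    injective : ∀ {i j} → i ∈ basisIndices p k m d → j ∈ basisIndices p k m d →
                basisExponent i ≡ basisExponent j → i ≡ j
    injective {l , a , c} {l′ , a′ , c′} i∈ j∈ eq with Vec.∷ʳ-injective _ _ eq
    ... | digits≡ , refl
      with digits-injective p (proj₁ (IsBasisIndex.admissible (∈-basisIndices⁻ p k m {d = d} i∈)))
                              (proj₁ (IsBasisIndex.admissible (∈-basisIndices⁻ p k m {d = d} j∈))) digits≡
    ... | refl , refl = refl

  basisMonomial-∈BG : ∀ {d l a c} → IsBasisIndex p k m d l a c →
                      BGdeg p k m d (mono (+ 1) (basisExponent (l , a , c)))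
  basisMonomial-∈BG {d} {l} {a} {c} i with IsBasisIndex.top i
  ... | refl = (generators , agree) , homogeneous
    where
    open IsBasisIndex i
    T : Vec ℕ k
    T = addV (scaleV p c) a
    generators : List (FPoly k × Σ (Vec ℕ k) (Admissible p k))
    generators = ((+ 1 , c) ∷ [] , a , admissible) ∷ []
    X : Poly (suc k)
    X = evalF p k ((+ 1 , c) ∷ []) ⊗ genPoly k q a
    by-height : ∀ b {l′} → l′ < s ⊎ l′ ≡ s →
                coeff (mono (+ 1) (T ∷ʳ s)) (b ∷ʳ l′) ≡ coeff (X ++ []) (b ∷ʳ l′)
    by-height b {l′} (inj₁ l′<s) = begin
      coeffᵗ (+ 1 , T ∷ʳ s) (b ∷ʳ l′) ℤ.+ + 0
        ≡⟨ cong (ℤ._+ + 0) (coeffᵗ-≢ (+ 1) (λ eq → ℕ.<⇒≢ l′<s (sym (Vec.∷ʳ-injectiveʳ T b eq)))) ⟩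
      + 0 ℤ.+ + 0
        ≡⟨ cong (ℤ._+ + 0) (coeff-evalF⊗genPoly-below p k q 2≤p ((+ 1 , c) ∷ []) a b l′<s) ⟨
      coeff X (b ∷ʳ l′) ℤ.+ coeff [] (b ∷ʳ l′)
        ≡⟨ coeff-++ X [] (b ∷ʳ l′) ⟨
      coeff (X ++ []) (b ∷ʳ l′)
        ∎
      where open ≡-Reasoning
    by-height b (inj₂ refl) = begin
      coeffᵗ (+ 1 , T ∷ʳ s) (b ∷ʳ s) ℤ.+ + 0
        ≡⟨ cong (ℤ._+ + 0) (coeffᵗ-∷ʳ (+ 1) T s b) ⟩
      coeffᵗ (+ 1 , T) b ℤ.+ + 0
        ≡⟨ coeff-evalF⊗genPoly-top p k q 2≤p ((+ 1 , c) ∷ []) a b ⟨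
      coeff X (b ∷ʳ s)
        ≡⟨ ℤ.+-identityʳ _ ⟨
      coeff X (b ∷ʳ s) ℤ.+ coeff [] (b ∷ʳ s)
        ≡⟨ coeff-++ X [] (b ∷ʳ s) ⟨
      coeff (X ++ []) (b ∷ʳ s)
        ∎
      where open ≡-Reasoning
    agree : EqR p q (mono (+ 1) (T ∷ʳ s)) (X ++ [])
    agree e e-red with Vec.initLast e
    ... | b , l′ , refl = ≡⇒≡[mod] p (by-height b (ℕ.m≤n⇒m<n∨m≡n (<q⇒≤s (proj₂ (All-∷ʳ⁻ b e-red)))))
    homogeneous : HomogR p q d (mono (+ 1) (T ∷ʳ s))
    homogeneous e e-red Σe≢d = ≡⇒≡[mod] p (trans (ℤ.+-identityʳ (coeffᵗ (+ 1 , T ∷ʳ s) e))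
      (coeffᵗ-≢ (+ 1) λ eq → Σe≢d (trans (cong Vec.sum (sym eq)) (trans (basisExponent-degree s a c) degree))))

  -- Below x_n^s the generators of B_G have no terms, and at x_n^s their terms are the monomials
  -- x^(p x + a) x_n^s with a admissible, which are basis monomials once reduced and of degree d.
  BG-supported : ∀ {d w} → BGdeg p k m d w → ∀ {e} → Reduced q e → e ∉ basisMonomials d →
                 coeff w e ≡ + 0 [mod p ]
  BG-supported {d} {w} ((generators , w≡) , homogeneous) {e} e-red e∉ with Vec.sum e ℕ.≟ d
  ... | no  Σe≢d = homogeneous e e-red Σe≢d
  ... | yes Σe≡d with Vec.initLast e
  ... | b , l , refl = subst (λ z → coeff w (b ∷ʳ l) ≡ z [mod p ])
                             (coeff-concatMap-≡0 _ (b ∷ʳ l) vanishes generators)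
                             (w≡ (b ∷ʳ l) e-red)
    where
    b-red : Reduced q b
    b-red = proj₁ (All-∷ʳ⁻ b e-red)
    l<q : l < q
    l<q = proj₂ (All-∷ʳ⁻ b e-red)
    not-basis : l ≡ s → ∀ a → Admissible p k a → ∀ x → addV (scaleV p x) a ≢ b
    not-basis refl a adm x refl = e∉ (∈-map⁺ basisExponent (∈-basisIndices⁺ p k m index))
      where
      index : IsBasisIndex p k m d s a x
      index = record
        { top        = refl
        ; admissible = adm
        ; bounded    = digits-<⁻ p x a b-red
        ; degree     = trans (sym (basisExponent-degree s a x)) Σe≡d
        }
    vanishes : ∀ (t : FPoly k × Σ (Vec ℕ k) (Admissible p k)) →
               coeff (evalF p k (proj₁ t) ⊗ genPoly k q (proj₁ (proj₂ t))) (b ∷ʳ l) ≡ + 0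
    vanishes (h , a , adm) with ℕ.m≤n⇒m<n∨m≡n (<q⇒≤s l<q)
    ... | inj₁ l<s  = coeff-evalF⊗genPoly-below p k q 2≤p h a b l<s
    ... | inj₂ refl = trans (coeff-evalF⊗genPoly-top p k q 2≤p h a b)
                            (coeff-images-absent p k q 2≤p h a b (not-basis refl a adm))

  BG-HasDim : ∀ d → HasDim p q (BGdeg p k m d) (length (basisMonomials d))
  BG-HasDim d =
    monomials-HasDim p q (BGdeg p k m d) (basisMonomials-unique d) reduced in-BG (λ {w} → BG-supported {d} {w})
    where
    reduced : ∀ {v} → v ∈ basisMonomials d → Reduced q v
    reduced v∈ with ∈-map⁻ basisExponent v∈
    ... | i , i∈ , refl = basisExponent-reduced (∈-basisIndices⁻ p k m {d = d} i∈)
    in-BG : ∀ {v} → v ∈ basisMonomials d → BGdeg p k m d (mono (+ 1) v)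
    in-BG v∈ with ∈-map⁻ basisExponent v∈
    ... | i , i∈ , refl = basisMonomial-∈BG (∈-basisIndices⁻ p k m {d = d} i∈)

lemma7p1 : (p k m e : ℕ) → Prime p → 1 ≤ k → 1 ≤ m → e ∣ (p ∸ 1) →
    (ω : ℤ) → HasOrderMod p ω e →
    (d : ℕ) → Σ ℕ λ r → (coeffU (hilbRHS p k m) d ≡ + r) × HasDim p (p ^ m) (BGdeg p k m d) r
-- B_G is given by explicit generators.
lemma7p1 p k zero     e p-prime _ () _ ω _ d
lemma7p1 p k (suc m′) e p-prime _ _  _ ω _ d =
  length (basisMonomials p k m′ 2≤p d) ,
  trans (hilbRHS-Counts p k (suc m′) 2≤p d) (cong +_ (sym (List.length-map _ (basisIndices p k (suc m′) d)))) ,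
  BG-HasDim p k m′ 2≤p d
  where
  2≤p : 2 ≤ p
  2≤p = nonTrivial⇒n>1 p {{prime⇒nonTrivial p-prime}}
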